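{- Let $k \ge 2$ and $j$ be integers with $0 < j \le 2^{k-2}$. Write $j - 1 = a_{k-1}2^{k-2} + a_{k-2}2^{k-3} + \cdots + a_1 2^0$ with $a_i \in \{0,1\}$ (so $a_{k-1} = 0$), and let $C$ be the set of even vertices of $Q_k$ that either equal $0^k$ or have $0^{k-1-i}1$ as a prefix for some $i$ with $a_i = 1$. Then for every odd vertex $v$ of $Q_k$, there is a path of length $2^k - 2j$ in $Q_k \setminus C$ starting at $v$.
   Context: $Q_k$ is the $k$-dimensional hypercube: vertex set $\{0,1\}^k$, two vertices adjacent iff they differ in exactly one coordinate. A vertex is even (resp. odd) if the number of $1$'s in it is even (resp. odd). The length of a path is its number of edges. $Q_k \setminus C$ denotes the subgraph induced on $\{0,1\}^k \setminus C$. $0^{t}$ denotes the string of $t$ zeros, and a string $x$ has prefix $p$ if its first $|p|$ coordinates equal $p$. -}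

module Defs where

open import Data.Bool using (Bool; true; false)
open import Data.Nat using (ℕ; zero; suc; _+_; _∸_; _^_; _≤_; _<_; _%_; _/_)
open import Data.Nat.Properties using ()
open import Data.Vec using (Vec; []; _∷_; lookup; replicate; take)
open import Data.Fin using (Fin)
open import Data.List using (List; []; _∷_; length)
open import Data.List.Relation.Unary.All using (All)
open import Data.List.Relation.Unary.Unique.Propositional using (Unique)
open import Data.Product using (Σ; _×_; ∃; ∃-syntax)
open import Data.Sum using (_⊎_)
open import Relation.Binary.PropositionalEquality using (_≡_)
open import Relation.Nullary using (¬_)

Vertex : ℕ → Set
Vertex k = Vec Bool k

ones : ∀ {k} → Vertex k → ℕ
ones [] = 0
ones (true ∷ x) = suc (ones x)
ones (false ∷ x) = ones x

hamming : ∀ {k} → Vertex k → Vertex k → ℕ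
hamming [] [] = 0
hamming (true ∷ x) (true ∷ y) = hamming x y
hamming (false ∷ x) (false ∷ y) = hamming x y
hamming (true ∷ x) (false ∷ y) = suc (hamming x y)
hamming (false ∷ x) (true ∷ y) = suc (hamming x y)

Adj : ∀ {k} → Vertex k → Vertex k → Set
Adj x y = hamming x y ≡ 1

Even Odd : ∀ {k} → Vertex k → Set
Even x = ones x % 2 ≡ 0
Odd  x = ones x % 2 ≡ 1

Walk : ∀ {k} → List (Vertex k) → Set
Walk [] = Data.Unit.⊤ where import Data.Unit
Walk (x ∷ []) = Data.Unit.⊤ where import Data.Unit
Walk (x ∷ y ∷ xs) = Adj x y × Walk (y ∷ xs)

PathFromAvoiding : ∀ {k} → (Vertex k → Set) → Vertex k → ℕ → Set
PathFromAvoiding {k} C v ℓ =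
  Σ (List (Vertex k)) λ ps → Σ (List (Vertex k)) λ rest →
    (ps ≡ v ∷ rest) × Walk ps × Unique ps × All (λ x → ¬ C x) ps
    × (length rest ≡ ℓ)

-- binary digit a_i of n: n = Σ_{i≥1} a_i 2^(i-1)
-- digit n 1 = n mod 2, digit n (i+1) = digit (n div 2) i
digit : ℕ → ℕ → ℕ
digit n zero = 0
digit n (suc zero) = n % 2
digit n (suc (suc i)) = digit (n / 2) (suc i)

HasPrefixZerosOne : ∀ {k} → ℕ → Vertex k → Set
HasPrefixZerosOne m [] = Data.Empty.⊥ where import Data.Empty
HasPrefixZerosOne zero (b ∷ x) = b ≡ true
HasPrefixZerosOne (suc m) (b ∷ x) = (b ≡ false) × HasPrefixZerosOne m x

C : (k j : ℕ) → Vertex k → Set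
C k j x = Even x ×
  ((x ≡ replicate k false) ⊎
   (∃[ i ] (1 ≤ i × i ≤ k ∸ 1 × digit (j ∸ 1) i ≡ 1 × HasPrefixZerosOne (k ∸ 1 ∸ i) x)))

module Submission where

-- The bits c_{N} … c_1 of a number (most significant first) determine a set
-- F(cs) of even vertices of Q_{N+1}: F([]) = {0} in Q_1, and in
-- Q_{N+2} = 1·Q_{N+1} ∪ 0·Q_{N+1} the set F(c ∷ cs) consists of all even
-- vertices of the top half if c = 1, together with 0·F(cs).  For n = j − 1
-- the set C of the theorem is contained in F(0 ∷ digits of n).
--
-- The construction rests on three classical facts about Q_{n+1}, proved
-- first by induction on n: it is Hamilton-laceable (a Hamiltonian path joins
-- any two vertices of opposite parity), and simple paths missing exactly one
-- vertex exist both from any vertex and between any two distinct vertices of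
-- equal parity.  Then, by induction on cs, every odd vertex u either starts
-- a simple path in Q_{N+1} ∖ F(cs) of a prescribed length, or is missed by
-- such a path starting at some odd vertex; when the next bit is 0 the free
-- top half can be traversed to turn this into a path from every odd vertex.

open import Defs
open import Data.Nat using (ℕ; zero; suc; _+_; _*_; _^_; _∸_; _≤_; _<_; s≤s; _≡ᵇ_; _%_; _/_)
open import Data.Nat.Properties
  using (suc-injective; +-suc; +-assoc; +-comm; *-comm; m+n∸n≡m; m∸n+n≡m; 0≢1+n)
open import Data.Nat.DivMod using (m%n<n; m<n*o⇒m/o<n; m≡m%n+[m/n]*n; %-distribˡ-+)
open import Data.Nat.Tactic.RingSolver using (solve-∀)
open import Data.Bool using (Bool; true; false; not; _xor_; _∧_)
open import Data.Bool.Properties using (not-involutive; not-injective; not-¬; ∧-zeroʳ)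
open import Data.Vec using (Vec; []; _∷_; replicate; head; _∷ʳ_)
open import Data.Vec.Properties using (∷-injectiveˡ; ∷-injectiveʳ)
open import Data.List using (List; []; _∷_; _++_; map; length)
open import Data.List.Properties using (length-++; length-map)
open import Data.List.Relation.Unary.All using (All; []; _∷_)
import Data.List.Relation.Unary.All as All
import Data.List.Relation.Unary.All.Properties as All
open import Data.List.Relation.Unary.Unique.Propositional using (Unique)
import Data.List.Relation.Unary.Unique.Propositional.Properties as Unique
open import Data.List.Relation.Unary.AllPairs using ([]; _∷_)
open import Data.List.Relation.Binary.Disjoint.Propositional using (Disjoint)
open import Data.Product using (Σ; _×_; _,_)
open import Data.Sum using (_⊎_; inj₁; inj₂)
open import Data.Empty using (⊥-elim)
open import Data.Unit using (tt)
open import Relation.Binary.PropositionalEquality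
  using (_≡_; _≢_; refl; sym; trans; cong; cong₂; subst; module ≡-Reasoning)
open import Relation.Nullary using (¬_)

parity : ∀ {n} → Vertex n → Bool
parity [] = false
parity (b ∷ x) = b xor parity x

bitValue : Bool → ℕ
bitValue true = 1
bitValue false = 0

ones-parity : ∀ {n} (x : Vertex n) → ones x % 2 ≡ bitValue (parity x)
ones-parity [] = refl
ones-parity (false ∷ x) = ones-parity x
ones-parity (true ∷ x) = begin
  (1 + ones x) % 2                 ≡⟨ %-distribˡ-+ 1 (ones x) 2 ⟩
  (1 + ones x % 2) % 2             ≡⟨ cong (λ r → (1 + r) % 2) (ones-parity x) ⟩
  (1 + bitValue (parity x)) % 2    ≡⟨ flipBit (parity x) ⟩
  bitValue (not (parity x))        ∎
  where
  open ≡-Reasoning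
  flipBit : ∀ b → (1 + bitValue b) % 2 ≡ bitValue (not b)
  flipBit true = refl
  flipBit false = refl

odd-parity : ∀ {n} (x : Vertex n) → Odd x → parity x ≡ true
odd-parity x odd with parity x | ones-parity x
... | true | _ = refl
... | false | e = ⊥-elim (0≢1+n (trans (sym e) odd))

even-parity : ∀ {n} (x : Vertex n) → Even x → parity x ≡ false
even-parity x even with parity x | ones-parity x
... | false | _ = refl
... | true | e = ⊥-elim (0≢1+n (trans (sym even) e))

flip : ∀ {n} → Vertex (suc n) → Vertex (suc n)
flip (b ∷ x) = not b ∷ x

flip-parity : ∀ {n} (x : Vertex (suc n)) → parity (flip x) ≡ not (parity x)
flip-parity (true ∷ x) = sym (not-involutive (parity x))
flip-parity (false ∷ x) = refl

hamming-self : ∀ {n} (x : Vertex n) → hamming x x ≡ 0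
hamming-self [] = refl
hamming-self (true ∷ x) = hamming-self x
hamming-self (false ∷ x) = hamming-self x

hamming-zero : ∀ {n} {x y : Vertex n} → hamming x y ≡ 0 → x ≡ y
hamming-zero {x = []} {[]} _ = refl
hamming-zero {x = true ∷ x} {true ∷ y} h = cong (true ∷_) (hamming-zero h)
hamming-zero {x = false ∷ x} {false ∷ y} h = cong (false ∷_) (hamming-zero h)
hamming-zero {x = true ∷ x} {false ∷ y} ()
hamming-zero {x = false ∷ x} {true ∷ y} ()

adj-cons : ∀ {n} b {x y : Vertex n} → Adj x y → Adj (b ∷ x) (b ∷ y)
adj-cons true e = e
adj-cons false e = e

cross : ∀ {n} {a b : Bool} {x : Vertex n} → a ≢ b → Adj (a ∷ x) (b ∷ x)
cross {a = true} {true} a≢b = ⊥-elim (a≢b refl)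
cross {a = true} {false} {x} _ = cong suc (hamming-self x)
cross {a = false} {true} {x} _ = cong suc (hamming-self x)
cross {a = false} {false} a≢b = ⊥-elim (a≢b refl)

adj-parity : ∀ {n} {x y : Vertex n} → Adj x y → parity y ≡ not (parity x)
adj-parity {x = []} {[]} ()
adj-parity {x = true ∷ x} {true ∷ y} e = cong not (adj-parity {x = x} e)
adj-parity {x = false ∷ x} {false ∷ y} e = adj-parity {x = x} e
adj-parity {x = true ∷ x} {false ∷ y} e rewrite hamming-zero {x = x} (suc-injective e) =
  sym (not-involutive (parity y))
adj-parity {x = false ∷ x} {true ∷ y} e rewrite hamming-zero {x = x} (suc-injective e) = refl

data Path {n : ℕ} : Vertex n → Vertex n → Set where
  [_]    : (x : Vertex n) → Path x x
  _∷⟨_⟩_ : (x : Vertex n) {y z : Vertex n} → Adj x y → Path y z → Path x z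

rest : ∀ {n} {x y : Vertex n} → Path x y → List (Vertex n)
vertices : ∀ {n} {x y : Vertex n} → Path x y → List (Vertex n)
rest [ x ] = []
rest (x ∷⟨ _ ⟩ p) = vertices p
vertices {x = x} p = x ∷ rest p

isWalk : ∀ {n} {x y : Vertex n} (p : Path x y) → Walk (vertices p)
isWalk [ x ] = tt
isWalk (x ∷⟨ e ⟩ [ y ]) = e , tt
isWalk (x ∷⟨ e ⟩ (y ∷⟨ e′ ⟩ p)) = e , isWalk (y ∷⟨ e′ ⟩ p)

_++⟨_⟩_ : ∀ {n} {x y z w : Vertex n} → Path x y → Adj y z → Path z w → Path x w
[ x ] ++⟨ e ⟩ q = x ∷⟨ e ⟩ q
(x ∷⟨ e′ ⟩ p) ++⟨ e ⟩ q = x ∷⟨ e′ ⟩ (p ++⟨ e ⟩ q)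

vertices-++ : ∀ {n} {x y z w : Vertex n} (p : Path x y) (e : Adj y z) (q : Path z w) →
  vertices (p ++⟨ e ⟩ q) ≡ vertices p ++ vertices q
vertices-++ [ x ] e q = refl
vertices-++ (x ∷⟨ e′ ⟩ p) e q = cong (x ∷_) (vertices-++ p e q)

lift : ∀ {n} a {x y : Vertex n} → Path x y → Path (a ∷ x) (a ∷ y)
lift a [ x ] = [ a ∷ x ]
lift a (x ∷⟨ e ⟩ p) = (a ∷ x) ∷⟨ adj-cons a e ⟩ lift a p

vertices-lift : ∀ {n} a {x y : Vertex n} (p : Path x y) →
  vertices (lift a p) ≡ map (a ∷_) (vertices p)
vertices-lift a [ x ] = refl
vertices-lift a (x ∷⟨ e ⟩ p) = cong ((a ∷ x) ∷_) (vertices-lift a p)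

record SimplePath {n} (x y : Vertex n) (ℓ : ℕ) : Set where
  constructor ⟨_,_,_⟩
  field
    trail    : Path x y
    distinct : Unique (vertices trail)
    size     : length (rest trail) ≡ ℓ
open SimplePath

stay : ∀ {n} (x : Vertex n) → SimplePath x x 0
stay x = ⟨ [ x ] , [] ∷ [] , refl ⟩

resize : ∀ {n} {x y : Vertex n} {ℓ ℓ′} → ℓ ≡ ℓ′ → SimplePath x y ℓ → SimplePath x y ℓ′
resize e ⟨ t , d , s ⟩ = ⟨ t , d , trans s e ⟩

prepend : ∀ {n} {x y w : Vertex n} {ℓ} → Adj x y → (p : SimplePath y w ℓ) →
  All (x ≢_) (vertices (trail p)) → SimplePath x w (suc ℓ)
prepend {x = x} e p fresh = ⟨ x ∷⟨ e ⟩ trail p , fresh ∷ distinct p , cong suc (size p) ⟩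

append : ∀ {n} {x y z w : Vertex n} {ℓ₁ ℓ₂} (p : SimplePath x y ℓ₁) → Adj y z →
  (q : SimplePath z w ℓ₂) → Disjoint (vertices (trail p)) (vertices (trail q)) →
  SimplePath x w (ℓ₁ + suc ℓ₂)
append {ℓ₁ = ℓ₁} {ℓ₂} p e q disjoint = record
  { trail    = trail p ++⟨ e ⟩ trail q
  ; distinct = subst Unique (sym (vertices-++ (trail p) e (trail q)))
                 (Unique.++⁺ (distinct p) (distinct q) disjoint)
  ; size     = suc-injective (begin
      length (vertices (trail p ++⟨ e ⟩ trail q))
        ≡⟨ cong length (vertices-++ (trail p) e (trail q)) ⟩
      length (vertices (trail p) ++ vertices (trail q))
        ≡⟨ length-++ (vertices (trail p)) ⟩
      suc (length (rest (trail p))) + suc (length (rest (trail q)))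
        ≡⟨ cong₂ (λ s t → suc s + suc t) (size p) (size q) ⟩
      suc ℓ₁ + suc ℓ₂ ∎) }
  where open ≡-Reasoning

All-append : ∀ {n} {P : Vertex n → Set} {x y z w : Vertex n} {ℓ₁ ℓ₂}
  (p : SimplePath x y ℓ₁) (e : Adj y z) (q : SimplePath z w ℓ₂)
  (disjoint : Disjoint (vertices (trail p)) (vertices (trail q))) →
  All P (vertices (trail p)) → All P (vertices (trail q)) →
  All P (vertices (trail (append p e q disjoint)))
All-append {P = P} p e q _ Pp Pq =
  subst (All P) (sym (vertices-++ (trail p) e (trail q))) (All.++⁺ Pp Pq)

raise : ∀ {n} a {x y : Vertex n} {ℓ} → SimplePath x y ℓ → SimplePath (a ∷ x) (a ∷ y) ℓ
raise a p = record
  { trail    = lift a (trail p)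
  ; distinct = subst Unique (sym (vertices-lift a (trail p)))
                 (Unique.map⁺ ∷-injectiveʳ (distinct p))
  ; size     = suc-injective (trans (cong length (vertices-lift a (trail p)))
                 (trans (length-map (a ∷_) (vertices (trail p))) (cong suc (size p)))) }

All-raise : ∀ {n} {P : Vertex (suc n) → Set} a {x y : Vertex n} {ℓ} (p : SimplePath x y ℓ) →
  All (λ z → P (a ∷ z)) (vertices (trail p)) → All P (vertices (trail (raise a p)))
All-raise {P = P} a p Pp = subst (All P) (sym (vertices-lift a (trail p))) (All.map⁺ Pp)

raised-disjoint : ∀ {n} {a b : Bool} {x y z w : Vertex n} {ℓ₁ ℓ₂} → a ≢ b →
  (p : SimplePath x y ℓ₁) (q : SimplePath z w ℓ₂) →
  Disjoint (vertices (trail (raise a p))) (vertices (trail (raise b q)))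
raised-disjoint {a = a} {b} a≢b p q (inP , inQ) =
  a≢b (trans (sym (All.lookup (onSide a p) inP)) (All.lookup (onSide b q) inQ))
  where
  onSide : ∀ c {u v} {ℓ} (r : SimplePath u v ℓ) →
    All (λ z → head z ≡ c) (vertices (trail (raise c r)))
  onSide c r = All-raise c r (All.universal (λ _ → refl) _)

join : ∀ {n} {a b : Bool} {x y w : Vertex n} {ℓ₁ ℓ₂} → a ≢ b →
  SimplePath x y ℓ₁ → SimplePath y w ℓ₂ → SimplePath (a ∷ x) (b ∷ w) (ℓ₁ + suc ℓ₂)
join {a = a} {b} a≢b p q = append (raise a p) (cross a≢b) (raise b q) (raised-disjoint a≢b p q)

All-join : ∀ {n} {P : Vertex (suc n) → Set} {a b : Bool} {x y w : Vertex n} {ℓ₁ ℓ₂}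
  (a≢b : a ≢ b) (p : SimplePath x y ℓ₁) (q : SimplePath y w ℓ₂) →
  All (λ z → P (a ∷ z)) (vertices (trail p)) → All (λ z → P (b ∷ z)) (vertices (trail q)) →
  All P (vertices (trail (join a≢b p q)))
All-join {a = a} {b} a≢b p q Pp Pq =
  All-append (raise a p) (cross a≢b) (raise b q) (raised-disjoint a≢b p q) (All-raise a p Pp) (All-raise b q Pq)

avoid-other-half : ∀ {n} {a b : Bool} {x : Vertex n} → a ≢ b → (l : List (Vertex n)) →
  All (λ z → (a ∷ x) ≢ (b ∷ z)) l
avoid-other-half a≢b = All.universal (λ _ e → a≢b (∷-injectiveˡ e))

avoid-same-half : ∀ {n} {a : Bool} {x : Vertex n} {l : List (Vertex n)} →
  All (x ≢_) l → All (λ z → (a ∷ x) ≢ (a ∷ z)) l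
avoid-same-half = All.map (λ x≢z e → x≢z (∷-injectiveʳ e))

-- 2 ^ n ∸ 1, the number of edges of a Hamiltonian path of Q_n
hamLength : ℕ → ℕ
hamLength zero = zero
hamLength (suc n) = suc (hamLength n + hamLength n)

double : ∀ m → 2 ^ m + 2 ^ m ≡ 2 ^ suc m
double m = cong (2 ^ m +_) (sym (+-comm (2 ^ m) 0))

suc-hamLength : ∀ n → suc (hamLength n) ≡ 2 ^ n
suc-hamLength zero = refl
suc-hamLength (suc n) = begin
  suc (suc (hamLength n + hamLength n))   ≡⟨ cong suc (sym (+-suc (hamLength n) (hamLength n))) ⟩
  suc (hamLength n) + suc (hamLength n)   ≡⟨ cong₂ _+_ (suc-hamLength n) (suc-hamLength n) ⟩
  2 ^ n + 2 ^ n                           ≡⟨ double n ⟩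
  2 ^ suc n                               ∎
  where open ≡-Reasoning

Laceable : ℕ → Set
Laceable n = ∀ (x y : Vertex n) → parity y ≡ not (parity x) → SimplePath x y (hamLength n)

-- In a Hamilton-laceable Q_n, a simple path x ⇝ y with first edge x — u lifts
-- to a·x ⇝ a·y by replacing that edge with a detour a·x, ¬a·x ⇝ ¬a·u, a·u
-- through a Hamiltonian path of the other half-cube.
detour : ∀ {n} → Laceable n → ∀ a {x y : Vertex n} {ℓ} → x ≢ y →
  SimplePath x y ℓ → SimplePath (a ∷ x) (a ∷ y) (suc (hamLength n + ℓ))
detour lace a x≢y ⟨ [ _ ] , _ , _ ⟩ = ⊥-elim (x≢y refl)
detour {n} lace a {x} {y} _ ⟨ _∷⟨_⟩_ _ {u} e q , fresh ∷ distinctQ , sz ⟩ =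
  resize (cong (λ t → suc (hamLength n + t)) sz)
    (prepend (cross a≢¬a) through
      (All-join ¬a≢a H tail (avoid-other-half a≢¬a _) (avoid-same-half fresh)))
  where
  a≢¬a : a ≢ not a
  a≢¬a = not-¬ refl
  ¬a≢a : not a ≢ a
  ¬a≢a e = a≢¬a (sym e)
  H : SimplePath x u (hamLength n)
  H = lace x u (adj-parity {x = x} e)
  tail : SimplePath u y (length (rest q))
  tail = ⟨ q , distinctQ , refl ⟩
  through : SimplePath (not a ∷ x) (a ∷ y) (hamLength n + suc (length (rest q)))
  through = join ¬a≢a H tail

parity-separates : ∀ {n} {x y : Vertex n} → parity y ≡ not (parity x) → x ≢ y
parity-separates e refl = not-¬ refl e

lace-within : ∀ {n} → Laceable (suc n) → ∀ a (x y : Vertex (suc n)) → parity y ≡ not (parity x) →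
  SimplePath (a ∷ x) (a ∷ y) (hamLength (suc (suc n)))
lace-within lace a x y e = detour lace a (parity-separates e) (lace x y e)

lace-across : ∀ {n} → Laceable (suc n) → ∀ {a b} → a ≢ b → (x y : Vertex (suc n)) →
  parity y ≡ parity x → SimplePath (a ∷ x) (b ∷ y) (hamLength (suc (suc n)))
lace-across {n} lace a≢b x y e = resize (+-suc (hamLength (suc n)) (hamLength (suc n)))
  (join a≢b (lace x (flip x) (flip-parity x)) (lace (flip x) y flipped))
  where
  flipped : parity y ≡ not (parity (flip x))
  flipped = trans e (trans (sym (not-involutive _)) (cong not (sym (flip-parity x))))

laceable : ∀ n → Laceable (suc n)
laceable zero (true ∷ []) (false ∷ []) _ = join (λ ()) (stay []) (stay [])
laceable zero (false ∷ []) (true ∷ []) _ = join (λ ()) (stay []) (stay [])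
laceable zero (true ∷ []) (true ∷ []) ()
laceable zero (false ∷ []) (false ∷ []) ()
laceable (suc n) (true ∷ x) (true ∷ y) e = lace-within (laceable n) true x y (not-injective e)
laceable (suc n) (false ∷ x) (false ∷ y) e = lace-within (laceable n) false x y e
laceable (suc n) (true ∷ x) (false ∷ y) e = lace-across (laceable n) (λ ()) x y (trans e (not-involutive _))
laceable (suc n) (false ∷ x) (true ∷ y) e = lace-across (laceable n) (λ ()) x y (not-injective e)

-- From a·x in Q_{n+2}: a
-- Hamiltonian path of a·Q_{n+1} to a·(flip x), the crossing edge, and
-- recursively such a path from ¬a·(flip x) in the other half.
nearHamFrom : ∀ n (x : Vertex (suc n)) →
  Σ (Vertex (suc n)) λ w → parity w ≡ parity x × SimplePath x w (hamLength n + hamLength n)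
nearHamFrom zero x = x , refl , stay x
nearHamFrom (suc n) (a ∷ x) with nearHamFrom n (flip x)
... | w , w∼flipx , F =
  (not a ∷ w) , endParity a (trans w∼flipx (flip-parity x)) ,
  join (not-¬ refl) (laceable n x (flip x) (flip-parity x)) F
  where
  endParity : ∀ a {p q} → q ≡ not p → not a xor q ≡ a xor p
  endParity true e = e
  endParity false e = trans (cong not e) (not-involutive _)

NearLaceable : ℕ → Set
NearLaceable n = ∀ (x y : Vertex (suc n)) → parity y ≡ parity x → x ≢ y →
  SimplePath x y (hamLength n + hamLength n)

near-within : ∀ n → NearLaceable n → ∀ a (x y : Vertex (suc n)) → parity y ≡ parity x →
  (a ∷ x) ≢ (a ∷ y) → SimplePath (a ∷ x) (a ∷ y) (hamLength (suc n) + hamLength (suc n))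
near-within n near a x y e ax≢ay =
  resize (sym (+-suc (hamLength (suc n)) (hamLength n + hamLength n)))
    (detour (laceable n) a x≢y (near x y e x≢y))
  where
  x≢y : x ≢ y
  x≢y x≡y = ax≢ay (cong (a ∷_) x≡y)

near-across : ∀ n {a b} → a ≢ b → (x y : Vertex (suc n)) → parity y ≡ not (parity x) →
  SimplePath (a ∷ x) (b ∷ y) (hamLength (suc n) + hamLength (suc n))
near-across n a≢b x y e with nearHamFrom n x
... | w , w∼x , F =
  resize (+-suc (hamLength n + hamLength n) (hamLength (suc n)))
    (join a≢b F (laceable n w y (trans e (cong not (sym w∼x)))))

nearLaceable : ∀ n → NearLaceable n
nearLaceable zero (true ∷ []) (true ∷ []) _ x≢y = ⊥-elim (x≢y refl)
nearLaceable zero (false ∷ []) (false ∷ []) _ x≢y = ⊥-elim (x≢y refl)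
nearLaceable zero (true ∷ []) (false ∷ []) ()
nearLaceable zero (false ∷ []) (true ∷ []) ()
nearLaceable (suc n) (true ∷ x) (true ∷ y) e =
  near-within n (nearLaceable n) true x y (not-injective e)
nearLaceable (suc n) (false ∷ x) (false ∷ y) e = near-within n (nearLaceable n) false x y e
nearLaceable (suc n) (true ∷ x) (false ∷ y) e _ = near-across n (λ ()) x y e
nearLaceable (suc n) (false ∷ x) (true ∷ y) e _ =
  near-across n (λ ()) x y (trans (sym (not-involutive _)) (cong not e))

-- F(cs) ⊆ Q_{N+1} for bits cs = c_N … c_1; note that 1·x is even iff x is odd
forbidden : ∀ {N} → Vec Bool N → Vertex (suc N) → Bool
forbidden [] (b ∷ []) = not b
forbidden (c ∷ cs) (true ∷ x) = c ∧ parity x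
forbidden (c ∷ cs) (false ∷ x) = forbidden cs x

Allowed : ∀ {N} → Vec Bool N → Vertex (suc N) → Set
Allowed cs x = forbidden cs x ≡ false

odd-allowed : ∀ {N} (cs : Vec Bool N) (x : Vertex (suc N)) → parity x ≡ true → Allowed cs x
odd-allowed [] (true ∷ []) _ = refl
odd-allowed [] (false ∷ []) ()
odd-allowed (c ∷ cs) (true ∷ x) odd = trans (cong (c ∧_) (not-injective odd)) (∧-zeroʳ c)
odd-allowed (c ∷ cs) (false ∷ x) odd = odd-allowed cs x odd

-- the length of the path built from an odd vertex: each 0-bit contributes
-- a whole half-cube and the crossing edge into it
pathLength : ∀ {N} → Vec Bool N → ℕ
pathLength [] = 0
pathLength {suc N} (false ∷ cs) = hamLength (suc N) + suc (pathLength cs)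
pathLength (true ∷ cs) = pathLength cs

record AvoidingPath {N} (cs : Vec Bool N) (x : Vertex (suc N)) : Set where
  constructor avoiding
  field
    end    : Vertex (suc N)
    route  : SimplePath x end (pathLength cs)
    avoids : All (Allowed cs) (vertices (trail route))
open AvoidingPath

Viable : ∀ {N} → Vec Bool N → Vertex (suc N) → Set
Viable {N} cs u = AvoidingPath cs u ⊎
  Σ (Vertex (suc N)) λ z → parity z ≡ true ×
    Σ (AvoidingPath cs z) λ p → All (u ≢_) (vertices (trail (route p)))

AllViable : ∀ {N} → Vec Bool N → Set
AllViable {N} cs = (u : Vertex (suc N)) → parity u ≡ true → Viable cs u

parity-zeros : ∀ n → parity (replicate n false) ≡ false
parity-zeros zero = refl
parity-zeros (suc n) = parity-zeros n

someAvoidingPath : ∀ {N} {cs : Vec Bool N} → AllViable cs →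
  Σ (Vertex (suc N)) λ z → parity z ≡ true × AvoidingPath cs z
someAvoidingPath {N} viable with viable (true ∷ replicate N false) (cong not (parity-zeros N))
... | inj₁ p = _ , cong not (parity-zeros N) , p
... | inj₂ (z , z-odd , p , _) = z , z-odd , p

-- an avoiding path copied into the bottom half 0·Q_{N+1}, which is all that
-- remains usable when the top half loses its even vertices
lower : ∀ {N} {cs : Vec Bool N} {x : Vertex (suc N)} →
  AvoidingPath cs x → AvoidingPath (true ∷ cs) (false ∷ x)
lower (avoiding w p ok) = avoiding (false ∷ w) (raise false p) (All-raise false p ok)

-- If the top half 1·Q_{N+1} is free, every odd vertex v of Q_{N+2} starts an
-- avoiding path.  For v = 1·y: a Hamiltonian path of the top half to 1·z,
-- then an avoiding path from 0·z.  For v = 0·u: either an avoiding path from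
-- 0·u followed by a Hamiltonian path of the top half, or the edge to 1·u, a
-- near-Hamiltonian path of the top half to 1·z, and an avoiding path from
-- 0·z that misses 0·u.
extend : ∀ {N} {cs : Vec Bool N} → AllViable cs →
  (v : Vertex (suc (suc N))) → parity v ≡ true → AvoidingPath (false ∷ cs) v
extend {N} viable (true ∷ y) odd with someAvoidingPath viable
... | z , z-odd , avoiding w Q okQ =
  avoiding (false ∷ w) (join (λ ()) H Q) (All-join (λ ()) H Q (All.universal (λ _ → refl) _) okQ)
  where
  H : SimplePath y z (hamLength (suc N))
  H = laceable N y z (trans z-odd (sym odd))
extend {N} {cs} viable (false ∷ u) odd with viable u odd
... | inj₁ (avoiding w Q okQ) =
  avoiding (true ∷ flip w) (resize reorder (join (λ ()) Q H))
    (All-join (λ ()) Q H okQ (All.universal (λ _ → refl) _))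
  where
  H : SimplePath w (flip w) (hamLength (suc N))
  H = laceable N w (flip w) (flip-parity w)
  reorder : pathLength cs + suc (hamLength (suc N)) ≡ hamLength (suc N) + suc (pathLength cs)
  reorder = trans (+-suc (pathLength cs) _)
    (trans (cong suc (+-comm (pathLength cs) _)) (sym (+-suc (hamLength (suc N)) _)))
... | inj₂ (z , z-odd , avoiding w Q okQ , missQ) =
  avoiding (false ∷ w) (prepend (cross {a = false} {true} {u} (λ ())) through fresh)
    (odd-allowed cs u odd ∷ All-join (λ ()) S Q (All.universal (λ _ → refl) _) okQ)
  where
  S : SimplePath u z (hamLength N + hamLength N)
  S = nearLaceable N u z (trans z-odd (sym odd)) (All.head missQ)
  through : SimplePath (true ∷ u) (false ∷ w) (hamLength N + hamLength N + suc (pathLength cs))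
  through = join (λ ()) S Q
  fresh : All ((false ∷ u) ≢_) (vertices (trail through))
  fresh = All-join (λ ()) S Q (avoid-other-half (λ ()) _) (avoid-same-half missQ)

-- The invariant holds for every cs, by induction: a 0-bit is handled by
-- `extend`; for a 1-bit only the bottom half is usable, and an odd vertex of
-- the top half is missed by any path lowered into the bottom half.
viable : ∀ {N} (cs : Vec Bool N) → AllViable cs
viable [] (true ∷ []) _ = inj₁ (avoiding _ (stay _) (refl ∷ []))
viable [] (false ∷ []) ()
viable (false ∷ cs) u odd = inj₁ (extend (viable cs) u odd)
viable (true ∷ cs) (false ∷ u) odd with viable cs u odd
... | inj₁ p = inj₁ (lower p)
... | inj₂ (z , z-odd , p , miss) =
  inj₂ ((false ∷ z) , z-odd , lower p , All-raise false (route p) (avoid-same-half miss))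
viable (true ∷ cs) (true ∷ u) _ with someAvoidingPath (viable cs)
... | z , z-odd , p =
  inj₂ ((false ∷ z) , z-odd , lower p , All-raise false (route p) (avoid-other-half (λ ()) _))

value : ∀ {N} → Vec Bool N → ℕ
value [] = 0
value {suc N} (b ∷ cs) = bitValue b * 2 ^ N + value cs

pathLength-value : ∀ {N} (cs : Vec Bool N) → pathLength cs + 2 * suc (value cs) ≡ 2 ^ suc N
pathLength-value [] = refl
pathLength-value {suc N} (false ∷ cs) = begin
  hamLength (suc N) + suc (pathLength cs) + 2 * suc (value cs)
    ≡⟨ +-assoc (hamLength (suc N)) (suc (pathLength cs)) _ ⟩
  hamLength (suc N) + suc (pathLength cs + 2 * suc (value cs))
    ≡⟨ +-suc (hamLength (suc N)) _ ⟩
  suc (hamLength (suc N)) + (pathLength cs + 2 * suc (value cs))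
    ≡⟨ cong₂ _+_ (suc-hamLength (suc N)) (pathLength-value cs) ⟩
  2 ^ suc N + 2 ^ suc N
    ≡⟨ double (suc N) ⟩
  2 ^ suc (suc N) ∎
  where open ≡-Reasoning
pathLength-value {suc N} (true ∷ cs) = begin
  pathLength cs + 2 * suc (1 * 2 ^ N + value cs)
    ≡⟨ regroup (pathLength cs) (2 ^ N) (value cs) ⟩
  pathLength cs + 2 * suc (value cs) + (2 ^ N + 2 ^ N)
    ≡⟨ cong₂ _+_ (pathLength-value cs) (double N) ⟩
  2 ^ suc N + 2 ^ suc N
    ≡⟨ double (suc N) ⟩
  2 ^ suc (suc N) ∎
  where
  open ≡-Reasoning
  regroup : ∀ L P V → L + 2 * suc (1 * P + V) ≡ L + 2 * suc V + (P + P)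
  regroup = solve-∀

digits : (m n : ℕ) → Vec Bool m
digits zero n = []
digits (suc m) n = (digit n (suc m) ≡ᵇ 1) ∷ digits m n

digits-snoc : ∀ m n → digits (suc m) n ≡ digits m (n / 2) ∷ʳ (n % 2 ≡ᵇ 1)
digits-snoc zero n = refl
digits-snoc (suc m) n = cong ((digit (n / 2) (suc m) ≡ᵇ 1) ∷_) (digits-snoc m n)

value-∷ʳ : ∀ {N} (cs : Vec Bool N) b → value (cs ∷ʳ b) ≡ 2 * value cs + bitValue b
value-∷ʳ [] true = refl
value-∷ʳ [] false = refl
value-∷ʳ {suc N} (c ∷ cs) b =
  trans (cong (bitValue c * 2 ^ suc N +_) (value-∷ʳ cs b))
        (shift (bitValue c) (2 ^ N) (value cs) (bitValue b))
  where
  shift : ∀ C P V B → C * (2 * P) + (2 * V + B) ≡ 2 * (C * P + V) + B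
  shift = solve-∀

bitValue-mod2 : ∀ n → bitValue (n % 2 ≡ᵇ 1) ≡ n % 2
bitValue-mod2 n with n % 2 | m%n<n n 2
... | 0 | _ = refl
... | 1 | _ = refl
... | suc (suc _) | s≤s (s≤s ())

half-< : ∀ m n → n < 2 ^ suc m → n / 2 < 2 ^ m
half-< m n lt = m<n*o⇒m/o<n {n} {2 ^ m} {2} (subst (n <_) (*-comm 2 (2 ^ m)) lt)

value-digits : ∀ m n → n < 2 ^ m → value (digits m n) ≡ n
value-digits zero zero _ = refl
value-digits zero (suc n) (s≤s ())
value-digits (suc m) n lt = begin
  value (digits (suc m) n)                      ≡⟨ cong value (digits-snoc m n) ⟩
  value (digits m (n / 2) ∷ʳ (n % 2 ≡ᵇ 1))      ≡⟨ value-∷ʳ (digits m (n / 2)) _ ⟩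
  2 * value (digits m (n / 2)) + bitValue (n % 2 ≡ᵇ 1)
    ≡⟨ cong₂ (λ q r → 2 * q + r) (value-digits m (n / 2) (half-< m n lt)) (bitValue-mod2 n) ⟩
  2 * (n / 2) + n % 2                           ≡⟨ swap (n / 2) (n % 2) ⟩
  n % 2 + n / 2 * 2                             ≡⟨ sym (m≡m%n+[m/n]*n n 2) ⟩
  n                                             ∎
  where
  open ≡-Reasoning
  swap : ∀ q r → 2 * q + r ≡ r + q * 2
  swap = solve-∀

digits-top : ∀ m n → n < 2 ^ m → digits (suc m) n ≡ false ∷ digits m n
digits-top m n lt = cong (λ d → (d ≡ᵇ 1) ∷ digits m n) (digit-top m n lt)
  where
  digit-top : ∀ m n → n < 2 ^ m → digit n (suc m) ≡ 0
  digit-top zero zero _ = refl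
  digit-top zero (suc n) (s≤s ())
  digit-top (suc m) n lt = digit-top m (n / 2) (half-< m n lt)

zeros-forbidden : ∀ {N} (cs : Vec Bool N) → forbidden cs (replicate (suc N) false) ≡ true
zeros-forbidden [] = refl
zeros-forbidden (c ∷ cs) = zeros-forbidden cs

prefix-forbidden : ∀ {M} n t i (x : Vertex (suc M)) → t + i ≡ M → 1 ≤ i → digit n i ≡ 1 →
  parity x ≡ false → HasPrefixZerosOne t x → forbidden (digits M n) x ≡ true
prefix-forbidden n zero zero x refl () _ _ _
prefix-forbidden n zero (suc i) (b ∷ x) refl _ aᵢ even refl
  rewrite aᵢ = not-injective even
prefix-forbidden n (suc t) i (b ∷ x) refl 1≤i aᵢ even (refl , prefix) =
  prefix-forbidden n t i x refl 1≤i aᵢ even prefix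

C-forbidden : ∀ m n (x : Vertex (suc m)) → C (suc m) (suc n) x → forbidden (digits m n) x ≡ true
C-forbidden m n x (_ , inj₁ refl) = zeros-forbidden (digits m n)
C-forbidden m n x (even , inj₂ (i , 1≤i , i≤m , aᵢ , prefix)) =
  prefix-forbidden n (m ∸ i) i x (m∸n+n≡m i≤m) 1≤i aᵢ (even-parity x even) prefix

-- With k = m + 2 and j = n + 1, the digits of j − 1 below 2 ^ m start with a
-- 0 in position m + 1, so an avoiding path from v exists by `extend`; it
-- avoids C ⊆ F and has length 2 ^ k − 2 j.
lemma5 : (k j : ℕ) → 2 ≤ k → 0 < j → j ≤ 2 ^ (k ∸ 2) →
    (v : Vertex k) → Odd v →
    PathFromAvoiding (C k j) v (2 ^ k ∸ 2 * j)
lemma5 zero _ () _ _ _ _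
lemma5 (suc zero) _ (s≤s ()) _ _ _ _
lemma5 (suc (suc m)) zero _ () _ _ _
lemma5 (suc (suc m)) (suc n) _ _ n<2^m v odd =
  vertices P , rest P , refl , isWalk P , distinct (route A) ,
  All.map avoidsC (avoids A) , length-ok
  where
  cs : Vec Bool (suc m)
  cs = false ∷ digits m n
  A : AvoidingPath cs v
  A = extend (viable (digits m n)) v (odd-parity v odd)
  P : Path v (end A)
  P = trail (route A)
  avoidsC : ∀ {x} → Allowed cs x → ¬ C (suc (suc m)) (suc n) x
  avoidsC {x} allowed x∈C
    with trans (sym allowed)
           (subst (λ ds → forbidden ds x ≡ true) (digits-top m n n<2^m) (C-forbidden (suc m) n x x∈C))
  ... | ()
  length-ok : length (rest P) ≡ 2 ^ suc (suc m) ∸ 2 * suc n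
  length-ok = begin
    length (rest P)                               ≡⟨ size (route A) ⟩
    pathLength cs                                 ≡⟨ sym (m+n∸n≡m (pathLength cs) (2 * suc n)) ⟩
    pathLength cs + 2 * suc n ∸ 2 * suc n
      ≡⟨ cong (λ t → pathLength cs + 2 * suc t ∸ 2 * suc n) (sym (value-digits m n n<2^m)) ⟩
    pathLength cs + 2 * suc (value cs) ∸ 2 * suc n
      ≡⟨ cong (_∸ 2 * suc n) (pathLength-value cs) ⟩
    2 ^ suc (suc m) ∸ 2 * suc n                   ∎
    where open ≡-Reasoning
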